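{- Let $m$ be a positive integer and let $\lambda_1,\dots,\lambda_m\in\{1,2\}$. Let $G$ be a graph and let $A_1,A_2$ be disjoint subsets of $V(G)$ such that $G$ has no edge between a vertex of $A_1$ and a vertex of $A_2$. If $\sum_{j=1}^m\lambda_j=|A_1|+|A_2|$ and $|A_i|\le m$ for each $i\in\{1,2\}$, then the vertices of $A_1\cup A_2$ can be assigned colors from $\{1,\dots,m\}$, each color $j$ being used exactly $\lambda_j$ times, so that the resulting coloring of the subgraph of $G$ induced by $A_1\cup A_2$ is proper.
   Context: A coloring of a set of vertices is proper if no two adjacent vertices of the set receive the same color. -}

module Defs where

open import Data.Nat using (ℕ)
open import Data.Fin using (Fin; _≟_)
open import Data.Fin.Subset using (Subset; inside; outside; _∈_; _∩_; _∪_; ∣_∣)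
open import Data.Vec using (tabulate; sum)
open import Data.Empty using (⊥)
open import Relation.Nullary using (¬_; does)
open import Data.Bool using (if_then_else_)
open import Level using (Level; suc; _⊔_) renaming (zero to lzero)

record Graph (n : ℕ) : Set₁ where
  field
    Adj   : Fin n → Fin n → Set
    sym   : ∀ {u v} → Adj u v → Adj v u
    irrefl : ∀ {u} → ¬ Adj u u
open Graph public

Disjoint : ∀ {n} → Subset n → Subset n → Set
Disjoint A B = ∀ v → v ∈ A → v ∈ B → ⊥

NoEdgeBetween : ∀ {n} → Graph n → Subset n → Subset n → Set
NoEdgeBetween G A B = ∀ u v → u ∈ A → v ∈ B → ¬ Adj G u v

colourClass : ∀ {n m} → (Fin n → Fin m) → Fin m → Subset n
colourClass c j = tabulate (λ v → if does (c v Data.Fin.≟ j) then inside else outside)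

ProperOn : ∀ {n m} → Graph n → Subset n → (Fin n → Fin m) → Set
ProperOn G S c = ∀ u v → u ∈ S → v ∈ S → Adj G u v → ¬ (c u ≡ c v)
  where open import Relation.Binary.PropositionalEquality using (_≡_)

sumFin : ∀ {m} → (Fin m → ℕ) → ℕ
sumFin f = sum (tabulate f)

module Submission where

-- Let P list the colours j with λⱼ = 2 and Q those with λⱼ = 1. Then P Q contains every colour
-- once, so |P| + |Q| = m, and W = P Q P contains colour j exactly λⱼ times, so |W| = |A₁| + |A₂|.
-- The first |A₁| ≤ m letters of W form a prefix of P Q, and since |A₂| ≤ m forces |A₁| ≥ |P|,
-- the remaining |A₂| letters form a suffix of Q P; both are repetition-free. Dealing the first
-- part to A₁ and the second to A₂ colours each of A₁, A₂ injectively, and as no edge joins A₁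
-- to A₂ the colouring is proper.

open import Defs hiding (sym)
import Data.Nat as ℕ
open import Data.Nat using (ℕ; zero; suc; _+_; _∸_; _≤_; z≤n; s≤s)
open import Data.Nat.Properties
  using (+-suc; suc-injective; +-comm; +-monoʳ-≤; +-cancelˡ-≤; ≤-trans; ≤-reflexive;
         m≤m+n; m≤n+m; m≤n⇒m⊓n≡m; m+n∸m≡n; +-commutativeSemigroup; module ≤-Reasoning)
open import Algebra.Properties.CommutativeSemigroup +-commutativeSemigroup using (interchange)
open import Data.Fin using (Fin; zero; suc)
import Data.Fin as Fin
open import Data.Fin.Subset using (Subset; inside; outside; _∈_; _∉_; _∩_; _∪_; ∣_∣)
open import Data.Fin.Subset.Properties using (x∈p∩q⁺; x∈p∩q⁻; x∈p∪q⁻; x∈p⇒∣p-x∣<∣p∣; ∣p∣≤∣x∷p∣; ∩-distribʳ-∪)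
open import Data.List using (List; []; _∷_; _++_; length; map; take; drop; filter; tabulate; allFin)
open import Data.List.Properties using (length-++; length-take; length-drop; take++drop≡id; map-tabulate; ++-assoc)
open import Data.Vec using ([]; _∷_; here; there; sum)
open import Data.Vec.Properties using (tabulate-cong)
open import Data.Bool using (true; false; if_then_else_)
open import Data.Product using (Σ; _×_; _,_; proj₁)
open import Data.Sum using (_⊎_; inj₁; inj₂)
open import Data.Empty using (⊥-elim)
open import Function using (id; _∘_)
open import Relation.Nullary using (¬_; yes; no; does; contradiction)
open import Relation.Nullary.Decidable using (dec-true)
open import Relation.Unary using (Pred; Decidable)
open import Relation.Binary.Definitions using (DecidableEquality)
open import Relation.Binary.PropositionalEquality

module Multiplicity {a} {A : Set a} (_≟_ : DecidableEquality A) where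

  count : A → List A → ℕ
  count j [] = 0
  count j (x ∷ xs) = if does (x ≟ j) then suc (count j xs) else count j xs

  count-++ : ∀ j xs ys → count j (xs ++ ys) ≡ count j xs + count j ys
  count-++ j [] ys = refl
  count-++ j (x ∷ xs) ys with does (x ≟ j)
  ... | true = cong suc (count-++ j xs ys)
  ... | false = count-++ j xs ys

  count-drop≤ : ∀ j k xs → count j (drop k xs) ≤ count j xs
  count-drop≤ j k xs = begin
    count j (drop k xs)                       ≤⟨ m≤n+m _ _ ⟩
    count j (take k xs) + count j (drop k xs) ≡⟨ count-++ j (take k xs) (drop k xs) ⟨
    count j (take k xs ++ drop k xs)          ≡⟨ cong (count j) (take++drop≡id k xs) ⟩
    count j xs                                ∎
    where open ≤-Reasoning

  count-take-++≤ : ∀ j {k} xs ys → k ≤ length xs → count j (take k (xs ++ ys)) ≤ count j xs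
  count-take-++≤ j {zero} xs ys _ = z≤n
  count-take-++≤ j {suc k} (x ∷ xs) ys (s≤s k≤) with does (x ≟ j)
  ... | true = s≤s (count-take-++≤ j xs ys k≤)
  ... | false = count-take-++≤ j xs ys k≤

  count-drop-++≤ : ∀ j {k} xs ys → length xs ≤ k → count j (drop k (xs ++ ys)) ≤ count j ys
  count-drop-++≤ j {k} [] ys _ = count-drop≤ j k ys
  count-drop-++≤ j {suc k} (x ∷ xs) ys (s≤s ≤k) = count-drop-++≤ j xs ys ≤k

  Distinct : List A → Set a
  Distinct xs = ∀ j → count j xs ≤ 1

  Distinct-take-xs++ys++xs : ∀ xs ys {k} → Distinct (xs ++ ys) → k ≤ length (xs ++ ys) →
                             Distinct (take k (xs ++ ys ++ xs))
  Distinct-take-xs++ys++xs xs ys {k} distinct k≤ j = begin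
    count j (take k (xs ++ ys ++ xs))   ≡⟨ cong (count j ∘ take k) (++-assoc xs ys xs) ⟨
    count j (take k ((xs ++ ys) ++ xs)) ≤⟨ count-take-++≤ j (xs ++ ys) xs k≤ ⟩
    count j (xs ++ ys)                  ≤⟨ distinct j ⟩
    1                                   ∎
    where open ≤-Reasoning

  Distinct-drop-xs++ys++xs : ∀ xs ys {k} → Distinct (xs ++ ys) → length xs ≤ k →
                             Distinct (drop k (xs ++ ys ++ xs))
  Distinct-drop-xs++ys++xs xs ys {k} distinct ≤k j = begin
    count j (drop k (xs ++ ys ++ xs))   ≤⟨ count-drop-++≤ j xs (ys ++ xs) ≤k ⟩
    count j (ys ++ xs)                  ≡⟨ count-++ j ys xs ⟩
    count j ys + count j xs             ≡⟨ +-comm (count j ys) (count j xs) ⟩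
    count j xs + count j ys             ≡⟨ count-++ j xs ys ⟨
    count j (xs ++ ys)                  ≤⟨ distinct j ⟩
    1                                   ∎
    where open ≤-Reasoning

  module _ {p} {P : Pred A p} (p? : Decidable P) where

    count-filter⁺ : ∀ {j} → P j → ∀ xs → count j (filter p? xs) ≡ count j xs
    count-filter⁺ pj [] = refl
    count-filter⁺ {j} pj (x ∷ xs) with p? x
    ... | yes _ with does (x ≟ j)
    ...   | true = cong suc (count-filter⁺ pj xs)
    ...   | false = count-filter⁺ pj xs
    count-filter⁺ {j} pj (x ∷ xs) | no ¬px with x ≟ j
    ...   | yes refl = contradiction pj ¬px
    ...   | no _ = count-filter⁺ pj xs

    count-filter⁻ : ∀ {j} → ¬ P j → ∀ xs → count j (filter p? xs) ≡ 0
    count-filter⁻ ¬pj [] = refl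
    count-filter⁻ {j} ¬pj (x ∷ xs) with p? x
    ... | no _ = count-filter⁻ ¬pj xs
    ... | yes px with x ≟ j
    ...   | yes refl = contradiction px ¬pj
    ...   | no _ = count-filter⁻ ¬pj xs

open module FinMultiplicity {m} = Multiplicity (Fin._≟_ {m})

count-zero-map-suc : ∀ {m} (xs : List (Fin m)) → count zero (map suc xs) ≡ 0
count-zero-map-suc [] = refl
count-zero-map-suc (x ∷ xs) = count-zero-map-suc xs

count-suc-map-suc : ∀ {m} (j : Fin m) xs → count (suc j) (map suc xs) ≡ count j xs
count-suc-map-suc j [] = refl
count-suc-map-suc j (x ∷ xs) with does (x Fin.≟ j)
... | true = cong suc (count-suc-map-suc j xs)
... | false = count-suc-map-suc j xs

count-allFin : ∀ {m} (j : Fin m) → count j (allFin m) ≡ 1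
count-allFin {suc m} zero =
  cong suc (trans (cong (count zero) (sym (map-tabulate {n = m} id suc))) (count-zero-map-suc (allFin m)))
count-allFin {suc m} (suc j) = begin
  count (suc j) (tabulate suc)          ≡⟨ cong (count (suc j)) (map-tabulate {n = m} id suc) ⟨
  count (suc j) (map suc (allFin m))    ≡⟨ count-suc-map-suc j (allFin m) ⟩
  count j (allFin m)                    ≡⟨ count-allFin j ⟩
  1                                     ∎
  where open ≡-Reasoning

count-filter-allFin : ∀ {m p} {P : Pred (Fin m) p} (p? : Decidable P) j →
  count j (filter p? (allFin m)) ≡ (if does (p? j) then 1 else 0)
count-filter-allFin p? j with p? j
... | yes pj = trans (count-filter⁺ p? pj (allFin _)) (count-allFin j)
... | no ¬pj = count-filter⁻ p? ¬pj (allFin _)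

sumFin-const-0 : ∀ m → sumFin {m} (λ _ → 0) ≡ 0
sumFin-const-0 zero = refl
sumFin-const-0 (suc m) = sumFin-const-0 m

sumFin-+ : ∀ {m} (f g : Fin m → ℕ) → sumFin (λ j → f j + g j) ≡ sumFin f + sumFin g
sumFin-+ {zero} f g = refl
sumFin-+ {suc m} f g = trans (cong (f zero + g zero +_) (sumFin-+ (f ∘ suc) (g ∘ suc)))
                             (interchange (f zero) (g zero) (sumFin (f ∘ suc)) (sumFin (g ∘ suc)))

sumFin-cong : ∀ {m} {f g : Fin m → ℕ} → (∀ j → f j ≡ g j) → sumFin f ≡ sumFin g
sumFin-cong f≗g = cong sum (tabulate-cong f≗g)

sumFin-count-singleton : ∀ {m} (x : Fin m) → sumFin (λ j → count j (x ∷ [])) ≡ 1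
sumFin-count-singleton {suc m} zero = cong suc (sumFin-const-0 m)
sumFin-count-singleton (suc x) = sumFin-count-singleton x

length≡sumFin-count : ∀ {m} (xs : List (Fin m)) → length xs ≡ sumFin (λ j → count j xs)
length≡sumFin-count {m} [] = sym (sumFin-const-0 m)
length≡sumFin-count (x ∷ xs) = begin
  1 + length xs                                           ≡⟨ cong₂ _+_ (sumFin-count-singleton x) (sym (length≡sumFin-count xs)) ⟨
  sumFin (λ j → count j (x ∷ [])) + sumFin (λ j → count j xs) ≡⟨ sumFin-+ (λ j → count j (x ∷ [])) (λ j → count j xs) ⟨
  sumFin (λ j → count j (x ∷ []) + count j xs)            ≡⟨ sumFin-cong (λ j → count-++ j (x ∷ []) xs) ⟨
  sumFin (λ j → count j (x ∷ xs))                         ∎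
  where open ≡-Reasoning

sumFin-const-1 : ∀ m → sumFin {m} (λ _ → 1) ≡ m
sumFin-const-1 zero = refl
sumFin-const-1 (suc m) = cong suc (sumFin-const-1 m)

length-from-counts : ∀ {m} {f : Fin m → ℕ} (xs : List (Fin m)) → (∀ j → count j xs ≡ f j) → length xs ≡ sumFin f
length-from-counts xs counts = trans (length≡sumFin-count xs) (sumFin-cong counts)

coloursByMultiplicity : ∀ {m} (λs : Fin m → ℕ) → (∀ j → λs j ≡ 1 ⊎ λs j ≡ 2) →
  Σ (List (Fin m)) λ P → Σ (List (Fin m)) λ Q →
  (∀ j → count j (P ++ Q) ≡ 1) × (∀ j → count j (P ++ Q ++ P) ≡ λs j)
coloursByMultiplicity {m} λs λ∈12 = twice , once , count-twice++once , count-twice++once++twice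
  where
  twice once : List (Fin m)
  twice = filter (λ j → λs j ℕ.≟ 2) (allFin m)
  once = filter (λ j → λs j ℕ.≟ 1) (allFin m)

  count-twice++once : ∀ j → count j (twice ++ once) ≡ 1
  count-twice++once j
    rewrite count-++ j twice once
          | count-filter-allFin (λ j → λs j ℕ.≟ 2) j | count-filter-allFin (λ j → λs j ℕ.≟ 1) j
    with λ∈12 j
  ... | inj₁ λj≡1 rewrite λj≡1 = refl
  ... | inj₂ λj≡2 rewrite λj≡2 = refl

  count-twice++once++twice : ∀ j → count j (twice ++ once ++ twice) ≡ λs j
  count-twice++once++twice j
    rewrite count-++ j twice (once ++ twice) | count-++ j once twice
          | count-filter-allFin (λ j → λs j ℕ.≟ 2) j | count-filter-allFin (λ j → λs j ℕ.≟ 1) j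
    with λ∈12 j
  ... | inj₁ λj≡1 rewrite λj≡1 = refl
  ... | inj₂ λj≡2 rewrite λj≡2 = refl

colourLists : ∀ {m} (λs : Fin m → ℕ) → (∀ j → λs j ≡ 1 ⊎ λs j ≡ 2) →
  ∀ {a b} → sumFin λs ≡ a + b → a ≤ m → b ≤ m →
  Σ (List (Fin m)) λ L₁ → Σ (List (Fin m)) λ L₂ →
  length L₁ ≡ a × length L₂ ≡ b × (∀ j → count j L₁ + count j L₂ ≡ λs j) × Distinct L₁ × Distinct L₂
colourLists {m} λs λ∈12 {a} {b} total a≤m b≤m with coloursByMultiplicity λs λ∈12
... | P , Q , count-P++Q , count-W =
  take a W , drop a W , length-take-W , length-drop-W , counts ,
  Distinct-take-xs++ys++xs P Q distinct-P++Q (subst (a ≤_) (sym length-P++Q) a≤m) ,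
  Distinct-drop-xs++ys++xs P Q distinct-P++Q length-P≤a
  where
  W = P ++ Q ++ P

  distinct-P++Q : Distinct (P ++ Q)
  distinct-P++Q j = ≤-reflexive (count-P++Q j)

  length-P++Q : length (P ++ Q) ≡ m
  length-P++Q = trans (length-from-counts (P ++ Q) count-P++Q) (sumFin-const-1 m)

  length-W : length W ≡ a + b
  length-W = trans (length-from-counts W count-W) total

  length-take-W : length (take a W) ≡ a
  length-take-W = trans (length-take a W) (trans (cong (ℕ._⊓_ a) length-W) (m≤n⇒m⊓n≡m (m≤m+n a b)))

  length-drop-W : length (drop a W) ≡ b
  length-drop-W = trans (length-drop a W) (trans (cong (_∸ a) length-W) (m+n∸m≡n a b))

  counts : ∀ j → count j (take a W) + count j (drop a W) ≡ λs j
  counts j = trans (sym (count-++ j (take a W) (drop a W))) (trans (cong (count j) (take++drop≡id a W)) (count-W j))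

  length-P≤a : length P ≤ a
  length-P≤a = +-cancelˡ-≤ (length (P ++ Q)) (length P) a (begin
    length (P ++ Q) + length P   ≡⟨ length-++ (P ++ Q) ⟨
    length ((P ++ Q) ++ P)       ≡⟨ cong length (++-assoc P Q P) ⟩
    length W                     ≡⟨ length-W ⟩
    a + b                        ≤⟨ +-monoʳ-≤ a (subst (b ≤_) (sym length-P++Q) b≤m) ⟩
    a + length (P ++ Q)          ≡⟨ +-comm a (length (P ++ Q)) ⟩
    length (P ++ Q) + a          ∎)
    where open ≤-Reasoning

Disjoint-tail : ∀ {n} {s t} {p q : Subset n} → Disjoint (s ∷ p) (t ∷ q) → Disjoint p q
Disjoint-tail disjoint v v∈p v∈q = disjoint (suc v) (there v∈p) (there v∈q)

∣p∪q∣≡∣p∣+∣q∣ : ∀ {n} (p q : Subset n) → Disjoint p q → ∣ p ∪ q ∣ ≡ ∣ p ∣ + ∣ q ∣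
∣p∪q∣≡∣p∣+∣q∣ [] [] _ = refl
∣p∪q∣≡∣p∣+∣q∣ (inside ∷ p) (inside ∷ q) disjoint = ⊥-elim (disjoint zero here here)
∣p∪q∣≡∣p∣+∣q∣ (inside ∷ p) (outside ∷ q) disjoint = cong suc (∣p∪q∣≡∣p∣+∣q∣ p q (Disjoint-tail disjoint))
∣p∪q∣≡∣p∣+∣q∣ (outside ∷ p) (inside ∷ q) disjoint =
  trans (cong suc (∣p∪q∣≡∣p∣+∣q∣ p q (Disjoint-tail disjoint))) (sym (+-suc ∣ p ∣ ∣ q ∣))
∣p∪q∣≡∣p∣+∣q∣ (outside ∷ p) (outside ∷ q) disjoint = ∣p∪q∣≡∣p∣+∣q∣ p q (Disjoint-tail disjoint)

∣[p∪q]∩r∣≡∣p∩r∣+∣q∩r∣ : ∀ {n} (p q r : Subset n) → Disjoint p q → ∣ (p ∪ q) ∩ r ∣ ≡ ∣ p ∩ r ∣ + ∣ q ∩ r ∣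
∣[p∪q]∩r∣≡∣p∩r∣+∣q∩r∣ p q r disjoint =
  trans (cong ∣_∣ (∩-distribʳ-∪ r p q)) (∣p∪q∣≡∣p∣+∣q∣ (p ∩ r) (q ∩ r) restricted)
  where
  restricted : Disjoint (p ∩ r) (q ∩ r)
  restricted v v∈p∩r v∈q∩r = disjoint v (proj₁ (x∈p∩q⁻ p r v∈p∩r)) (proj₁ (x∈p∩q⁻ q r v∈q∩r))

x∈p⇒1≤∣p∣ : ∀ {n} {p : Subset n} {x} → x ∈ p → 1 ≤ ∣ p ∣
x∈p⇒1≤∣p∣ x∈p = ≤-trans (s≤s z≤n) (x∈p⇒∣p-x∣<∣p∣ x∈p)

∣p∣≤1⇒x≡y : ∀ {n} {p : Subset n} {x y} → ∣ p ∣ ≤ 1 → x ∈ p → y ∈ p → x ≡ y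
∣p∣≤1⇒x≡y _ here here = refl
∣p∣≤1⇒x≡y (s≤s ∣p∣≤0) here (there y∈p) = contradiction (≤-trans (x∈p⇒1≤∣p∣ y∈p) ∣p∣≤0) λ ()
∣p∣≤1⇒x≡y (s≤s ∣p∣≤0) (there x∈p) here = contradiction (≤-trans (x∈p⇒1≤∣p∣ x∈p) ∣p∣≤0) λ ()
∣p∣≤1⇒x≡y {p = s ∷ p} ∣p∣≤1 (there x∈p) (there y∈p) =
  cong suc (∣p∣≤1⇒x≡y (≤-trans (∣p∣≤∣x∷p∣ s p) ∣p∣≤1) x∈p y∈p)

∈-colourClass : ∀ {n m} (c : Fin n → Fin m) {v j} → c v ≡ j → v ∈ colourClass c j
∈-colourClass c {zero} {j} cv≡j rewrite dec-true (c zero Fin.≟ j) cv≡j = here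
∈-colourClass c {suc v} cv≡j = there (∈-colourClass (c ∘ suc) cv≡j)

∩-colourClass-cong : ∀ {n m} (A : Subset n) {c c′ : Fin n → Fin m} j →
  (∀ v → v ∈ A → c v ≡ c′ v) → A ∩ colourClass c j ≡ A ∩ colourClass c′ j
∩-colourClass-cong [] j _ = refl
∩-colourClass-cong (inside ∷ A) j c≗c′ =
  cong₂ _∷_ (cong (λ x → if does (x Fin.≟ j) then inside else outside) (c≗c′ zero here))
            (∩-colourClass-cong A j (λ v v∈A → c≗c′ (suc v) (there v∈A)))
∩-colourClass-cong (outside ∷ A) j c≗c′ =
  cong (outside ∷_) (∩-colourClass-cong A j (λ v v∈A → c≗c′ (suc v) (there v∈A)))

ProperOn-classes≤1 : ∀ {n m} (G : Graph n) {A : Subset n} {c : Fin n → Fin m} →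
  (∀ j → ∣ A ∩ colourClass c j ∣ ≤ 1) → ProperOn G A c
ProperOn-classes≤1 G {A} {c} classes≤1 u v u∈A v∈A uv cu≡cv =
  irrefl G (subst (Adj G u) (sym u≡v) uv)
  where
  u≡v : u ≡ v
  u≡v = ∣p∣≤1⇒x≡y (classes≤1 (c v)) (x∈p∩q⁺ (u∈A , ∈-colourClass c cu≡cv)) (x∈p∩q⁺ (v∈A , ∈-colourClass c refl))

ProperOn-∪ : ∀ {n m} (G : Graph n) {A B : Subset n} {c : Fin n → Fin m} →
  NoEdgeBetween G A B → ProperOn G A c → ProperOn G B c → ProperOn G (A ∪ B) c
ProperOn-∪ G {A} {B} noEdge properA properB u v u∈ v∈ uv with x∈p∪q⁻ A B u∈ | x∈p∪q⁻ A B v∈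
... | inj₁ u∈A | inj₁ v∈A = properA u v u∈A v∈A uv
... | inj₁ u∈A | inj₂ v∈B = λ _ → noEdge u v u∈A v∈B uv
... | inj₂ u∈B | inj₁ v∈A = λ _ → noEdge v u v∈A u∈B (Graph.sym G uv)
... | inj₂ u∈B | inj₂ v∈B = properB u v u∈B v∈B uv

-- deal A L c gives the vertices of A, in increasing order, the successive entries of L;
-- it falls back to c outside A and once L is exhausted.
deal : ∀ {n m} → Subset n → List (Fin m) → (Fin n → Fin m) → Fin n → Fin m
deal (inside ∷ A) (x ∷ L) c zero = x
deal (inside ∷ A) (x ∷ L) c (suc v) = deal A L (c ∘ suc) v
deal (inside ∷ A) [] c v = c v
deal (outside ∷ A) L c zero = c zero
deal (outside ∷ A) L c (suc v) = deal A L (c ∘ suc) v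

deal-∉ : ∀ {n m} (A : Subset n) (L : List (Fin m)) c {v} → v ∉ A → deal A L c v ≡ c v
deal-∉ (inside ∷ A) (x ∷ L) c {zero} v∉A = contradiction here v∉A
deal-∉ (inside ∷ A) (x ∷ L) c {suc v} v∉A = deal-∉ A L (c ∘ suc) (v∉A ∘ there)
deal-∉ (inside ∷ A) [] c v∉A = refl
deal-∉ (outside ∷ A) L c {zero} v∉A = refl
deal-∉ (outside ∷ A) L c {suc v} v∉A = deal-∉ A L (c ∘ suc) (v∉A ∘ there)

∣∩colourClass-deal∣ : ∀ {n m} (A : Subset n) (L : List (Fin m)) c → length L ≡ ∣ A ∣ →
  ∀ j → ∣ A ∩ colourClass (deal A L c) j ∣ ≡ count j L
∣∩colourClass-deal∣ [] [] c _ j = refl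
∣∩colourClass-deal∣ (inside ∷ A) (x ∷ L) c ∣L∣≡∣A∣ j with does (x Fin.≟ j)
... | true = cong suc (∣∩colourClass-deal∣ A L (c ∘ suc) (suc-injective ∣L∣≡∣A∣) j)
... | false = ∣∩colourClass-deal∣ A L (c ∘ suc) (suc-injective ∣L∣≡∣A∣) j
∣∩colourClass-deal∣ (outside ∷ A) L c ∣L∣≡∣A∣ j = ∣∩colourClass-deal∣ A L (c ∘ suc) ∣L∣≡∣A∣ j

colourByLists : ∀ {n m} (d : Fin m) (G : Graph n) {A₁ A₂ : Subset n} (L₁ L₂ : List (Fin m)) →
  Disjoint A₁ A₂ → NoEdgeBetween G A₁ A₂ → length L₁ ≡ ∣ A₁ ∣ → length L₂ ≡ ∣ A₂ ∣ →
  Distinct L₁ → Distinct L₂ →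
  Σ (Fin n → Fin m) λ c →
    (∀ j → ∣ (A₁ ∪ A₂) ∩ colourClass c j ∣ ≡ count j L₁ + count j L₂) × ProperOn G (A₁ ∪ A₂) c
colourByLists d G {A₁} {A₂} L₁ L₂ disjoint noEdge ∣L₁∣ ∣L₂∣ distinct₁ distinct₂ =
  c , sizes , ProperOn-∪ G noEdge (ProperOn-classes≤1 G small₁) (ProperOn-classes≤1 G small₂)
  where
  c₁ c : Fin _ → Fin _
  c₁ = deal A₁ L₁ (λ _ → d)
  c = deal A₂ L₂ c₁

  size₁ : ∀ j → ∣ A₁ ∩ colourClass c j ∣ ≡ count j L₁
  size₁ j = trans (cong ∣_∣ (∩-colourClass-cong A₁ j (λ v v∈A₁ → deal-∉ A₂ L₂ c₁ (disjoint v v∈A₁))))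
                  (∣∩colourClass-deal∣ A₁ L₁ (λ _ → d) ∣L₁∣ j)

  size₂ : ∀ j → ∣ A₂ ∩ colourClass c j ∣ ≡ count j L₂
  size₂ = ∣∩colourClass-deal∣ A₂ L₂ c₁ ∣L₂∣

  sizes : ∀ j → ∣ (A₁ ∪ A₂) ∩ colourClass c j ∣ ≡ count j L₁ + count j L₂
  sizes j = trans (∣[p∪q]∩r∣≡∣p∩r∣+∣q∩r∣ A₁ A₂ (colourClass c j) disjoint) (cong₂ _+_ (size₁ j) (size₂ j))

  small₁ : ∀ j → ∣ A₁ ∩ colourClass c j ∣ ≤ 1
  small₁ j = subst (_≤ 1) (sym (size₁ j)) (distinct₁ j)

  small₂ : ∀ j → ∣ A₂ ∩ colourClass c j ∣ ≤ 1
  small₂ j = subst (_≤ 1) (sym (size₂ j)) (distinct₂ j)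

mainTheorem4 : (m : ℕ) → 1 ≤ m → (λs : Fin m → ℕ) → (∀ j → λs j ≡ 1 ⊎ λs j ≡ 2)
    → (n : ℕ) (G : Graph n) (A₁ A₂ : Subset n)
    → Disjoint A₁ A₂ → NoEdgeBetween G A₁ A₂
    → sumFin λs ≡ ∣ A₁ ∣ + ∣ A₂ ∣ → ∣ A₁ ∣ ≤ m → ∣ A₂ ∣ ≤ m
    → Σ (Fin n → Fin m) (λ c →
    (∀ j → ∣ (A₁ ∪ A₂) ∩ colourClass c j ∣ ≡ λs j) × ProperOn G (A₁ ∪ A₂) c)
mainTheorem4 (suc m) _ λs λ∈12 n G A₁ A₂ disjoint noEdge total ∣A₁∣≤m ∣A₂∣≤m
  with colourLists λs λ∈12 total ∣A₁∣≤m ∣A₂∣≤m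
... | L₁ , L₂ , ∣L₁∣ , ∣L₂∣ , counts , distinct₁ , distinct₂
  with colourByLists zero G L₁ L₂ disjoint noEdge ∣L₁∣ ∣L₂∣ distinct₁ distinct₂
... | c , sizes , proper = c , (λ j → trans (sizes j) (counts j)) , proper
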